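{- Let $a,\delta$ be positive integers with $a<\delta<2a$ and $\gcd(a,\delta)=1$, put $b=a+\delta$ and $d=\delta-a$. For $n\ge 0$ let $w_n = n + a\lfloor n/a\rfloor + b\lfloor n/\delta\rfloor$ and $g_n=w_{n+1}-w_n$. For each $\rho\in\{1,\dots,\delta-1\}$ let $n_\rho$ be the unique index $0\le n_\rho<a\delta$ with $g_{n_\rho}=a+1$ and $n_\rho+1\equiv\rho\pmod\delta$, and let $c(\rho)$ be the number of pairs of integers $(m,k)$ with $0\le m\le n_\rho<k$ and $g_m+g_{m+1}+\cdots+g_{k-1}=\delta$. Then $$\sum_{\rho=1}^{\delta-1}c(\rho)=\sum_{k=1}^{d}2k+(a-d-1)d=ad.$$ -}

module Defs where

open import Data.Nat using (ℕ; zero; suc; _+_; _*_; _∸_; _<_; _≟_; NonZero)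
open import Data.Nat.DivMod using (_/_; _%_)
open import Data.Product using (_×_)
open import Relation.Nullary.Decidable using (⌊_⌋)
open import Relation.Binary.PropositionalEquality using (_≡_)
open import Data.Bool using (if_then_else_)

sumFrom : (ℕ → ℕ) → ℕ → ℕ → ℕ
sumFrom f m zero    = 0
sumFrom f m (suc l) = f m + sumFrom f (suc m) l

-- Σ_{i=m}^{k-1} f i  (empty when k ≤ m)
sumRange : (ℕ → ℕ) → ℕ → ℕ → ℕ
sumRange f m k = sumFrom f m (k ∸ m)

w : (a δ : ℕ) .{{_ : NonZero a}} .{{_ : NonZero δ}} → ℕ → ℕ
w a δ n = n + a * (n / a) + (a + δ) * (n / δ)

-- g_n = w_{n+1} - w_n  (w is strictly increasing, so truncated subtraction is exact)
g : (a δ : ℕ) .{{_ : NonZero a}} .{{_ : NonZero δ}} → ℕ → ℕ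
g a δ n = w a δ (suc n) ∸ w a δ n

IsNRho : (a δ : ℕ) .{{_ : NonZero a}} .{{_ : NonZero δ}} → ℕ → ℕ → Set
IsNRho a δ ρ n = (n < a * δ) × (g a δ n ≡ suc a) × (suc n % δ ≡ ρ % δ)

ind : ℕ → ℕ → ℕ
ind x y = if ⌊ x ≟ y ⌋ then 1 else 0

-- c for index n: number of pairs (m,k) with 0 ≤ m ≤ n < k and g_m + ... + g_{k-1} = δ.
-- Since every g_i ≥ 1, such pairs have k - m ≤ δ, hence k ≤ n + δ; we enumerate
-- m = 0..n and k = n+1 .. n+δ.
cCount : (a δ : ℕ) .{{_ : NonZero a}} .{{_ : NonZero δ}} → ℕ → ℕ
cCount a δ n =
  sumFrom (λ m → sumFrom (λ k → ind (sumRange (g a δ) m k) δ) (suc n) δ) 0 (suc n)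

module Submission where

-- For m ≤ k, w_k - w_m = (k - m) + a A + (a + δ) B, where A and B count the
-- multiples of a and of δ in (m, k].  If (m, k] contains a multiple of a, this gap equals δ
-- only when A = 1 and B = 0 (because a + δ > δ and 2a > δ), that is, when k = m + d and no
-- multiple of δ lies in (m, k].  Writing p = n_ρ + 1, a multiple of a with p ≡ ρ (mod δ), the
-- pairs counted by c(ρ) are therefore (p - d + i, p + i) for the i < d with d ≤ i + ρ < δ.
-- For each i < d exactly δ - d = a residues ρ ∈ [1, δ) qualify, so the total is a d.  The index n_ρ
-- exists and is unique because n_ρ + 1 = j a with j < δ and multiplication by a is
-- invertible modulo δ.

open import Data.Bool using (if_then_else_)
open import Data.Nat
open import Data.Nat.Properties
open import Data.Nat.DivMod
open import Data.Nat.Divisibility using (_∣_; _∣?_; divides; divides-refl; ∣⇒≤; n∣m⇒m%n≡0)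
open import Data.Nat.Coprimality using (Coprime; coprime-Bézout; gcd≡1⇒coprime)
open import Data.Nat.GCD using (gcd; module Bézout)
open import Data.Nat.Tactic.RingSolver using (solve-∀)
open import Algebra.Properties.CommutativeSemigroup +-commutativeSemigroup using (xy∙z≈xz∙y; interchange)
open import Data.Product using (_×_; _,_; proj₁; proj₂; ∃-syntax)
open import Function.Bundles using (_⇔_; mk⇔; Equivalence)
open import Relation.Binary.PropositionalEquality
open import Relation.Nullary using (Dec; yes; no; ¬_; contradiction)
open import Relation.Nullary.Decidable using (⌊_⌋; _×-dec_)
open import Defs

sumFrom-cong : ∀ {f h} s l → (∀ x → s ≤ x → x < s + l → f x ≡ h x) →
               sumFrom f s l ≡ sumFrom h s l
sumFrom-cong s zero    f≡h = refl
sumFrom-cong s (suc l) f≡h = cong₂ _+_ (f≡h s ≤-refl (m<m+n s z<s))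
  (sumFrom-cong (suc s) l λ x s<x x<s+l → f≡h x (<⇒≤ s<x) (subst (x <_) (sym (+-suc s l)) x<s+l))

sumFrom-const : ∀ c s l → sumFrom (λ _ → c) s l ≡ l * c
sumFrom-const c s zero    = refl
sumFrom-const c s (suc l) = cong (c +_) (sumFrom-const c (suc s) l)

sumFrom-zero : ∀ {f} s l → (∀ x → s ≤ x → x < s + l → f x ≡ 0) → sumFrom f s l ≡ 0
sumFrom-zero s l f≡0 = trans (sumFrom-cong s l f≡0) (trans (sumFrom-const 0 s l) (*-zeroʳ l))

sumFrom-++ : ∀ f s l₁ l₂ → sumFrom f s (l₁ + l₂) ≡ sumFrom f s l₁ + sumFrom f (s + l₁) l₂
sumFrom-++ f s zero     l₂ = cong (λ t → sumFrom f t l₂) (sym (+-identityʳ s))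
sumFrom-++ f s (suc l₁) l₂ = begin
  f s + sumFrom f (suc s) (l₁ + l₂)
    ≡⟨ cong (f s +_) (sumFrom-++ f (suc s) l₁ l₂) ⟩
  f s + (sumFrom f (suc s) l₁ + sumFrom f (suc s + l₁) l₂)
    ≡⟨ sym (+-assoc (f s) _ _) ⟩
  f s + sumFrom f (suc s) l₁ + sumFrom f (suc s + l₁) l₂
    ≡⟨ cong (λ t → f s + sumFrom f (suc s) l₁ + sumFrom f t l₂) (sym (+-suc s l₁)) ⟩
  f s + sumFrom f (suc s) l₁ + sumFrom f (s + suc l₁) l₂   ∎
  where open ≡-Reasoning

sumFrom-shift : ∀ f t s l → sumFrom (λ x → f (t + x)) s l ≡ sumFrom f (t + s) l
sumFrom-shift f t s zero    = refl
sumFrom-shift f t s (suc l) = cong (f (t + s) +_)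
  (trans (sumFrom-shift f t (suc s) l) (cong (λ u → sumFrom f u l) (+-suc t s)))

sumFrom-distrib-+ : ∀ f h s l → sumFrom (λ x → f x + h x) s l ≡ sumFrom f s l + sumFrom h s l
sumFrom-distrib-+ f h s zero    = refl
sumFrom-distrib-+ f h s (suc l) = begin
  f s + h s + sumFrom (λ x → f x + h x) (suc s) l       ≡⟨ cong (f s + h s +_) (sumFrom-distrib-+ f h (suc s) l) ⟩
  f s + h s + (sumFrom f (suc s) l + sumFrom h (suc s) l) ≡⟨ interchange (f s) (h s) _ _ ⟩
  f s + sumFrom f (suc s) l + (h s + sumFrom h (suc s) l) ∎
  where open ≡-Reasoning

sumFrom-comm : ∀ (f : ℕ → ℕ → ℕ) s₁ l₁ s₂ l₂ →
  sumFrom (λ x → sumFrom (f x) s₂ l₂) s₁ l₁ ≡ sumFrom (λ y → sumFrom (λ x → f x y) s₁ l₁) s₂ l₂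
sumFrom-comm f s₁ zero     s₂ l₂ = sym (sumFrom-zero s₂ l₂ λ _ _ _ → refl)
sumFrom-comm f s₁ (suc l₁) s₂ l₂ = trans (cong (sumFrom (f s₁) s₂ l₂ +_) (sumFrom-comm f (suc s₁) l₁ s₂ l₂))
  (sym (sumFrom-distrib-+ (f s₁) (λ y → sumFrom (λ x → f x y) (suc s₁) l₁) s₂ l₂))

sumFrom-single : ∀ {f} s l x → s ≤ x → x < s + l →
                 (∀ y → s ≤ y → y < s + l → y ≢ x → f y ≡ 0) → sumFrom f s l ≡ f x
sumFrom-single s zero x s≤x x<s+0 _ = contradiction (subst (x <_) (+-identityʳ s) x<s+0) (≤⇒≯ s≤x)
sumFrom-single {f} s (suc l) x s≤x x<s+l others with s ≟ x
... | yes refl = begin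
  f s + sumFrom f (suc s) l ≡⟨ cong (f s +_) (sumFrom-zero (suc s) l λ y s<y y< →
                                   others y (<⇒≤ s<y) (subst (y <_) (sym (+-suc s l)) y<) (>⇒≢ s<y)) ⟩
  f s + 0                   ≡⟨ +-identityʳ (f s) ⟩
  f s                       ∎
  where open ≡-Reasoning
... | no s≢x = cong₂ _+_ (others s ≤-refl (m<m+n s z<s) s≢x)
  (sumFrom-single (suc s) l x (≤∧≢⇒< s≤x s≢x) (subst (x <_) (+-suc s l) x<s+l)
     λ y s<y y< → others y (<⇒≤ s<y) (subst (y <_) (sym (+-suc s l)) y<))

sumFrom-telescope : ∀ (f : ℕ → ℕ) → (∀ {i j} → i ≤ j → f i ≤ f j) →
  ∀ s l → sumFrom (λ i → f (suc i) ∸ f i) s l ≡ f (s + l) ∸ f s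
sumFrom-telescope f mono s zero    = trans (sym (n∸n≡0 (f s))) (cong (λ t → f t ∸ f s) (sym (+-identityʳ s)))
sumFrom-telescope f mono s (suc l) = begin
  f (suc s) ∸ f s + sumFrom (λ i → f (suc i) ∸ f i) (suc s) l
    ≡⟨ cong (f (suc s) ∸ f s +_) (sumFrom-telescope f mono (suc s) l) ⟩
  f (suc s) ∸ f s + (f (suc s + l) ∸ f (suc s))
    ≡⟨ +-∸-telescope (mono (n≤1+n s)) (mono (m≤m+n (suc s) l)) ⟩
  f (suc s + l) ∸ f s
    ≡⟨ cong (λ t → f t ∸ f s) (sym (+-suc s l)) ⟩
  f (s + suc l) ∸ f s                                        ∎
  where
  open ≡-Reasoning
  +-∸-telescope : ∀ {x y z} → x ≤ y → y ≤ z → (y ∸ x) + (z ∸ y) ≡ z ∸ x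
  +-∸-telescope {x} {y} {z} x≤y y≤z = +-cancelˡ-≡ x _ _ (begin
    x + ((y ∸ x) + (z ∸ y)) ≡⟨ sym (+-assoc x _ _) ⟩
    x + (y ∸ x) + (z ∸ y)   ≡⟨ cong (_+ (z ∸ y)) (m+[n∸m]≡n x≤y) ⟩
    y + (z ∸ y)             ≡⟨ m+[n∸m]≡n y≤z ⟩
    z                       ≡⟨ sym (m+[n∸m]≡n (≤-trans x≤y y≤z)) ⟩
    x + (z ∸ x)             ∎)

sumFrom-double : ∀ s l → sumFrom (λ k → 2 * k) (suc s) l + s * suc s ≡ (s + l) * suc (s + l)
sumFrom-double s zero    = cong (λ t → t * suc t) (sym (+-identityʳ s))
sumFrom-double s (suc l) = begin
  2 * suc s + sumFrom (λ k → 2 * k) (2 + s) l + s * suc s ≡⟨ regroup s (sumFrom (λ k → 2 * k) (2 + s) l) ⟩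
  sumFrom (λ k → 2 * k) (2 + s) l + suc s * (2 + s)      ≡⟨ sumFrom-double (suc s) l ⟩
  (suc s + l) * suc (suc s + l)                           ≡⟨ cong (λ t → t * suc t) (sym (+-suc s l)) ⟩
  (s + suc l) * suc (s + suc l)                           ∎
  where
  open ≡-Reasoning
  regroup : ∀ s x → 2 * suc s + x + s * suc s ≡ x + suc s * (2 + s)
  regroup = solve-∀

sumFrom-2k+[a∸d∸1]*d : ∀ {a d} → d < a → sumFrom (λ k → 2 * k) 1 d + (a ∸ d ∸ 1) * d ≡ a * d
sumFrom-2k+[a∸d∸1]*d {a} {d} d<a = begin
  sumFrom (λ k → 2 * k) 1 d + (a ∸ d ∸ 1) * d
    ≡⟨ cong₂ _+_ (trans (sym (+-identityʳ _)) (sumFrom-double 0 d))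
                 (cong (_* d) (trans (∸-+-assoc a d 1) (cong (a ∸_) (+-comm d 1)))) ⟩
  d * suc d + (a ∸ suc d) * d
    ≡⟨ regroup d (a ∸ suc d) ⟩
  (suc d + (a ∸ suc d)) * d
    ≡⟨ cong (_* d) (m+[n∸m]≡n d<a) ⟩
  a * d                                       ∎
  where
  open ≡-Reasoning
  regroup : ∀ d r → d * suc d + r * d ≡ (suc d + r) * d
  regroup = solve-∀

-- `ind x y` is definitionally `𝟙 (x ≟ y)`.
𝟙 : ∀ {P : Set} → Dec P → ℕ
𝟙 P? = if ⌊ P? ⌋ then 1 else 0

𝟙-yes : ∀ {P : Set} (P? : Dec P) → P → 𝟙 P? ≡ 1
𝟙-yes (yes _) _ = refl
𝟙-yes (no ¬p) p = contradiction p ¬p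

𝟙-no : ∀ {P : Set} (P? : Dec P) → ¬ P → 𝟙 P? ≡ 0
𝟙-no (yes p) ¬p = contradiction p ¬p
𝟙-no (no _)  _  = refl

𝟙-cong : ∀ {P Q : Set} (P? : Dec P) (Q? : Dec Q) → P ⇔ Q → 𝟙 P? ≡ 𝟙 Q?
𝟙-cong P? (yes q) P⇔Q = 𝟙-yes P? (Equivalence.from P⇔Q q)
𝟙-cong P? (no ¬q) P⇔Q = 𝟙-no P? (λ p → ¬q (Equivalence.to P⇔Q p))

sumFrom-𝟙-interval : ∀ lo hi s l → s ≤ lo → lo ≤ hi → hi ≤ s + l →
  sumFrom (λ x → 𝟙 (lo ≤? x ×-dec x <? hi)) s l ≡ hi ∸ lo
sumFrom-𝟙-interval lo hi s l s≤lo lo≤hi hi≤s+l = begin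
  sumFrom χ s l                                             ≡⟨ cong (sumFrom χ s) (sym l≡) ⟩
  sumFrom χ s (lo ∸ s + (hi ∸ lo + r))                      ≡⟨ sumFrom-++ χ s (lo ∸ s) (hi ∸ lo + r) ⟩
  sumFrom χ s (lo ∸ s) + sumFrom χ (s + (lo ∸ s)) (hi ∸ lo + r)
    ≡⟨ cong₂ _+_ below (cong (λ t → sumFrom χ t (hi ∸ lo + r)) s+[lo∸s]≡lo) ⟩
  0 + sumFrom χ lo (hi ∸ lo + r)                            ≡⟨ sumFrom-++ χ lo (hi ∸ lo) r ⟩
  sumFrom χ lo (hi ∸ lo) + sumFrom χ (lo + (hi ∸ lo)) r     ≡⟨ cong₂ _+_ inside above ⟩
  hi ∸ lo + 0                                               ≡⟨ +-identityʳ (hi ∸ lo) ⟩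
  hi ∸ lo                                                   ∎
  where
  open ≡-Reasoning
  χ : ℕ → ℕ
  χ x = 𝟙 (lo ≤? x ×-dec x <? hi)
  r : ℕ
  r = s + l ∸ hi
  s+[lo∸s]≡lo : s + (lo ∸ s) ≡ lo
  s+[lo∸s]≡lo = m+[n∸m]≡n s≤lo
  lo+[hi∸lo]≡hi : lo + (hi ∸ lo) ≡ hi
  lo+[hi∸lo]≡hi = m+[n∸m]≡n lo≤hi
  l≡ : lo ∸ s + (hi ∸ lo + r) ≡ l
  l≡ = +-cancelˡ-≡ s _ _ (begin
    s + (lo ∸ s + (hi ∸ lo + r)) ≡⟨ sym (+-assoc s (lo ∸ s) _) ⟩
    s + (lo ∸ s) + (hi ∸ lo + r) ≡⟨ cong (_+ (hi ∸ lo + r)) s+[lo∸s]≡lo ⟩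
    lo + (hi ∸ lo + r)           ≡⟨ sym (+-assoc lo (hi ∸ lo) r) ⟩
    lo + (hi ∸ lo) + r           ≡⟨ cong (_+ r) lo+[hi∸lo]≡hi ⟩
    hi + r                       ≡⟨ m+[n∸m]≡n hi≤s+l ⟩
    s + l                        ∎)
  below : sumFrom χ s (lo ∸ s) ≡ 0
  below = sumFrom-zero s (lo ∸ s) λ x _ x< →
    𝟙-no (lo ≤? x ×-dec x <? hi) λ (lo≤x , _) → <⇒≱ (subst (x <_) s+[lo∸s]≡lo x<) lo≤x
  inside : sumFrom χ lo (hi ∸ lo) ≡ hi ∸ lo
  inside = trans (sumFrom-cong lo (hi ∸ lo) λ x lo≤x x< →
                    𝟙-yes (lo ≤? x ×-dec x <? hi) (lo≤x , subst (x <_) lo+[hi∸lo]≡hi x<))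
                 (trans (sumFrom-const 1 lo (hi ∸ lo)) (*-identityʳ (hi ∸ lo)))
  above : sumFrom χ (lo + (hi ∸ lo)) r ≡ 0
  above = sumFrom-zero (lo + (hi ∸ lo)) r λ x hi≤x _ →
    𝟙-no (lo ≤? x ×-dec x <? hi) λ (_ , x<hi) → <⇒≱ x<hi (subst (_≤ x) lo+[hi∸lo]≡hi hi≤x)

m*n≤o⇒m≤o/n : ∀ {m n o} .{{_ : NonZero n}} → m * n ≤ o → m ≤ o / n
m*n≤o⇒m≤o/n {m} {n} {o} m*n≤o = subst (_≤ o / n) (m*n/n≡m m n) (/-monoˡ-≤ n m*n≤o)

m<[1+m/n]*n : ∀ m n .{{_ : NonZero n}} → m < suc (m / n) * n
m<[1+m/n]*n m n = subst (_< n + m / n * n) (sym (m≡m%n+[m/n]*n m n)) (+-monoˡ-< (m / n * n) (m%n<n m n))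

m/o<n/o⇒m<n : ∀ {m n o} .{{_ : NonZero o}} → m / o < n / o → m < n
m/o<n/o⇒m<n {m} {n} {o} m/o<n/o = ≰⇒> λ n≤m → <⇒≱ m/o<n/o (/-monoˡ-≤ o n≤m)

m<o≤n⇒m/d<n/d : ∀ {m n o d} .{{_ : NonZero d}} → d ∣ o → m < o → o ≤ n → m / d < n / d
m<o≤n⇒m/d<n/d {d = d} (divides-refl q) m<o o≤n = <-≤-trans (m<n*o⇒m/o<n {n = q} m<o) (m*n≤o⇒m≤o/n {q} {d} o≤n)

/-unique : ∀ {m n q} .{{_ : NonZero n}} → q * n ≤ m → m < suc q * n → m / n ≡ q
/-unique q*n≤m m<[1+q]*n = ≤-antisym (<⇒≤pred (m<n*o⇒m/o<n m<[1+q]*n)) (m*n≤o⇒m≤o/n q*n≤m)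

[m+n]/n≡1+m/n : ∀ m n .{{_ : NonZero n}} → (m + n) / n ≡ suc (m / n)
[m+n]/n≡1+m/n m n = trans (m/n≡1+[m∸n]/n (m≤n+m n m)) (cong (λ t → suc (t / n)) (m+n∸n≡m m n))

[m+kn]/n≡k : ∀ {m} k n .{{_ : NonZero n}} → m < n → (m + k * n) / n ≡ k
[m+kn]/n≡k {m} k n m<n = begin
  (m + k * n) / n   ≡⟨ +-distrib-/-∣ʳ m (divides-refl k) ⟩
  m / n + k * n / n ≡⟨ cong₂ _+_ (m<n⇒m/n≡0 m<n) (m*n/n≡m k n) ⟩
  k                 ∎
  where open ≡-Reasoning

[m+n]/o≡m/o⇔n≤r<o : ∀ {m n r q o} .{{_ : NonZero o}} → m + n ≡ r + q * o → r < o + n →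
                     ((m + n) / o ≡ m / o ⇔ (n ≤ r × r < o))
[m+n]/o≡m/o⇔n≤r<o {m} {n} {r} {q} {o} m+n≡r+qo r<o+n = mk⇔ to from
  where
  open ≤-Reasoning
  q≤[m+n]/o : q ≤ (m + n) / o
  q≤[m+n]/o = m*n≤o⇒m≤o/n (subst (q * o ≤_) (sym m+n≡r+qo) (m≤n+m (q * o) r))
  to : (m + n) / o ≡ m / o → n ≤ r × r < o
  to same = ≮⇒≥ r≮n , ≰⇒> o≰r
    where
    r≮n : ¬ r < n
    r≮n r<n = <⇒≱ (begin-strict
      m / o       <⟨ m<n*o⇒m/o<n (+-cancelʳ-< n m (q * o) (begin-strict
                       m + n     ≡⟨ trans m+n≡r+qo (+-comm r (q * o)) ⟩
                       q * o + r <⟨ +-monoʳ-< (q * o) r<n ⟩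
                       q * o + n ∎)) ⟩
      q           ≤⟨ q≤[m+n]/o ⟩
      (m + n) / o ∎) (≤-reflexive same)
    o≰r : ¬ o ≤ r
    o≰r o≤r = <⇒≱ (begin-strict
      m / o       <⟨ m<n*o⇒m/o<n (+-cancelʳ-< n m (suc q * o) (begin-strict
                       m + n         ≡⟨ m+n≡r+qo ⟩
                       r + q * o     <⟨ +-monoˡ-< (q * o) r<o+n ⟩
                       o + n + q * o ≡⟨ xy∙z≈xz∙y o n (q * o) ⟩
                       suc q * o + n ∎)) ⟩
      suc q       ≤⟨ m*n≤o⇒m≤o/n (subst (suc q * o ≤_) (sym m+n≡r+qo) (+-monoˡ-≤ (q * o) o≤r)) ⟩
      (m + n) / o ∎) (≤-reflexive same)
  from : n ≤ r × r < o → (m + n) / o ≡ m / o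
  from (n≤r , r<o) = trans (trans (/-congˡ m+n≡r+qo) ([m+kn]/n≡k q o r<o))
                           (sym (trans (/-congˡ m≡r∸n+qo) ([m+kn]/n≡k q o (≤-<-trans (m∸n≤m r n) r<o))))
    where
    m≡r∸n+qo : m ≡ r ∸ n + q * o
    m≡r∸n+qo = +-cancelʳ-≡ n m (r ∸ n + q * o) (trans m+n≡r+qo (trans (cong (_+ q * o) (sym (m∸n+n≡m n≤r)))
                                                                 (xy∙z≈xz∙y (r ∸ n) n (q * o))))

[1+m]/n≡𝟙[n∣1+m]+m/n : ∀ m n .{{_ : NonZero n}} → suc m / n ≡ 𝟙 (n ∣? suc m) + m / n
[1+m]/n≡𝟙[n∣1+m]+m/n m n with n ∣? suc m
... | yes (divides zero ())
... | yes (divides (suc q) 1+m≡[1+q]n) = begin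
  suc m / n           ≡⟨ /-congˡ 1+m≡[1+q]n ⟩
  suc q * n / n       ≡⟨ m*n/n≡m (suc q) n ⟩
  suc q               ≡⟨ cong suc (sym (/-unique q*n≤m (subst (m <_) 1+m≡[1+q]n ≤-refl))) ⟩
  suc (m / n)         ∎
  where
  open ≡-Reasoning
  q*n≤m : q * n ≤ m
  q*n≤m = <⇒≤pred (subst (q * n <_) (sym 1+m≡[1+q]n) (m<n+m (q * n) (>-nonZero⁻¹ n)))
... | no n∤1+m = /-unique (≤-trans (m/n*n≤m m n) (n≤1+n m))
  (≤∧≢⇒< (m<[1+m/n]*n m n) λ 1+m≡ → n∤1+m (divides (suc (m / n)) 1+m≡))

%-*-congˡ : ∀ {m n} k o .{{_ : NonZero o}} → m % o ≡ n % o → (m * k) % o ≡ (n * k) % o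
%-*-congˡ {m} {n} k o m%o≡n%o = begin
  (m * k) % o             ≡⟨ %-distribˡ-* m k o ⟩
  ((m % o) * (k % o)) % o ≡⟨ cong (λ t → (t * (k % o)) % o) m%o≡n%o ⟩
  ((n % o) * (k % o)) % o ≡⟨ %-distribˡ-* n k o ⟨
  (n * k) % o             ∎
  where open ≡-Reasoning

module _ {a δ : ℕ} .{{_ : NonZero δ}} (coprime : Coprime a δ) where

  private
    inverse : ∃[ x ] (x * a) % δ ≡ 1 % δ
    inverse with coprime-Bézout coprime
    ... | Bézout.+- x y 1+yδ≡xa = x , trans (%-congˡ (sym 1+yδ≡xa)) ([m+kn]%n≡m%n 1 y δ)
    -- Here x a ≡ -1 (mod δ), so (δ - 1) x is an inverse of a.
    ... | Bézout.-+ x y 1+xa≡yδ = D * x , (begin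
      (D * x * a) % δ           ≡⟨ [m+kn]%n≡m%n (D * x * a) 1 δ ⟨
      (D * x * a + 1 * δ) % δ   ≡⟨ %-congˡ (begin
        D * x * a + 1 * δ       ≡⟨ cong (D * x * a +_) (trans (*-identityˡ δ) (sym (m∸n+n≡m (>-nonZero⁻¹ δ)))) ⟩
        D * x * a + (D + 1)     ≡⟨ regroup₁ D x a ⟩
        D * (1 + x * a) + 1     ≡⟨ cong (λ t → D * t + 1) 1+xa≡yδ ⟩
        D * (y * δ) + 1         ≡⟨ regroup₂ D y δ ⟩
        1 + D * y * δ           ∎) ⟩
      (1 + D * y * δ) % δ       ≡⟨ [m+kn]%n≡m%n 1 (D * y) δ ⟩
      1 % δ                     ∎)
      where
      open ≡-Reasoning
      D : ℕ
      D = δ ∸ 1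
      regroup₁ : ∀ D x a → D * x * a + (D + 1) ≡ D * (1 + x * a) + 1
      regroup₁ = solve-∀
      regroup₂ : ∀ D y δ → D * (y * δ) + 1 ≡ 1 + D * y * δ
      regroup₂ = solve-∀

    x : ℕ
    x = proj₁ inverse

    *x-cancels-*a : ∀ i → (i * a * x) % δ ≡ i % δ
    *x-cancels-*a i = begin
      (i * a * x) % δ ≡⟨ %-congˡ (regroup i a x) ⟩
      (x * a * i) % δ ≡⟨ %-*-congˡ i δ (proj₂ inverse) ⟩
      (1 * i) % δ     ≡⟨ %-congˡ (*-identityˡ i) ⟩
      i % δ           ∎
      where
      open ≡-Reasoning
      regroup : ∀ i a x → i * a * x ≡ x * a * i
      regroup = solve-∀

  *-cancelʳ-% : ∀ {i j} → (i * a) % δ ≡ (j * a) % δ → i % δ ≡ j % δ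
  *-cancelʳ-% {i} {j} ia≡ja = begin
    i % δ           ≡⟨ *x-cancels-*a i ⟨
    (i * a * x) % δ ≡⟨ %-*-congˡ x δ ia≡ja ⟩
    (j * a * x) % δ ≡⟨ *x-cancels-*a j ⟩
    j % δ           ∎
    where open ≡-Reasoning

  *-surjectiveʳ-% : ∀ r → ∃[ j ] j < δ × (j * a) % δ ≡ r % δ
  *-surjectiveʳ-% r = (r * x) % δ , m%n<n (r * x) δ , (begin
    ((r * x) % δ * a) % δ ≡⟨ %-*-congˡ a δ (m%n%n≡m%n (r * x) δ) ⟩
    (r * x * a) % δ       ≡⟨ %-congˡ (regroup r x a) ⟩
    (r * a * x) % δ       ≡⟨ *x-cancels-*a r ⟩
    r % δ                 ∎)
    where
    open ≡-Reasoning
    regroup : ∀ r x a → r * x * a ≡ r * a * x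
    regroup = solve-∀

module _ (a δ : ℕ) .{{_ : NonZero a}} .{{_ : NonZero δ}} where

  w-difference : ∀ {m k} → m ≤ k →
    w a δ k ≡ w a δ m + ((k ∸ m) + a * (k / a ∸ m / a) + (a + δ) * (k / δ ∸ m / δ))
  w-difference {m} {k} m≤k = begin
    k + a * (k / a) + (a + δ) * (k / δ)
      ≡⟨ cong₂ _+_ (cong₂ (λ u v → u + a * v) (sym (m+[n∸m]≡n m≤k)) (sym (m+[n∸m]≡n (/-monoˡ-≤ a m≤k))))
                   (cong ((a + δ) *_) (sym (m+[n∸m]≡n (/-monoˡ-≤ δ m≤k)))) ⟩
    (m + (k ∸ m)) + a * (m / a + (k / a ∸ m / a)) + (a + δ) * (m / δ + (k / δ ∸ m / δ))
      ≡⟨ regroup a (a + δ) m (k ∸ m) (m / a) (k / a ∸ m / a) (m / δ) (k / δ ∸ m / δ) ⟩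
    w a δ m + ((k ∸ m) + a * (k / a ∸ m / a) + (a + δ) * (k / δ ∸ m / δ)) ∎
    where
    open ≡-Reasoning
    regroup : ∀ a b m x A₀ A B₀ B →
      (m + x) + a * (A₀ + A) + b * (B₀ + B) ≡ (m + a * A₀ + b * B₀) + (x + a * A + b * B)
    regroup = solve-∀

  w-mono : ∀ {m k} → m ≤ k → w a δ m ≤ w a δ k
  w-mono {m} {k} m≤k = subst (w a δ m ≤_) (sym (w-difference m≤k)) (m≤m+n (w a δ m) _)

  sumRange-g : ∀ {m k} → m ≤ k → sumRange (g a δ) m k ≡ w a δ k ∸ w a δ m
  sumRange-g {m} {k} m≤k = trans (sumFrom-telescope (w a δ) w-mono m (k ∸ m))
                                 (cong (λ t → w a δ t ∸ w a δ m) (m+[n∸m]≡n m≤k))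

  g-formula : ∀ n → g a δ n ≡ 1 + a * 𝟙 (a ∣? suc n) + (a + δ) * 𝟙 (δ ∣? suc n)
  g-formula n = begin
    w a δ (suc n) ∸ w a δ n
      ≡⟨ cong (_∸ w a δ n) (w-difference (n≤1+n n)) ⟩
    w a δ n + ((suc n ∸ n) + a * (suc n / a ∸ n / a) + (a + δ) * (suc n / δ ∸ n / δ)) ∸ w a δ n
      ≡⟨ m+n∸m≡n (w a δ n) _ ⟩
    (suc n ∸ n) + a * (suc n / a ∸ n / a) + (a + δ) * (suc n / δ ∸ n / δ)
      ≡⟨ cong₂ _+_ (cong₂ (λ u v → u + a * v) (m+n∸n≡m 1 n) (step a)) (cong ((a + δ) *_) (step δ)) ⟩
    1 + a * 𝟙 (a ∣? suc n) + (a + δ) * 𝟙 (δ ∣? suc n) ∎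
    where
    open ≡-Reasoning
    step : ∀ c .{{_ : NonZero c}} → suc n / c ∸ n / c ≡ 𝟙 (c ∣? suc n)
    step c = trans (cong (_∸ n / c) ([1+m]/n≡𝟙[n∣1+m]+m/n n c)) (m+n∸n≡m _ (n / c))

  g≡1+a⇒a∣1+n : ∀ n → g a δ n ≡ suc a → a ∣ suc n
  g≡1+a⇒a∣1+n n g≡1+a = from-𝟙 (a ∣? suc n) (δ ∣? suc n) (trans (sym (g-formula n)) g≡1+a)
    where
    from-𝟙 : (a∣? : Dec (a ∣ suc n)) (δ∣? : Dec (δ ∣ suc n)) →
             1 + a * 𝟙 a∣? + (a + δ) * 𝟙 δ∣? ≡ suc a → a ∣ suc n
    from-𝟙 (yes a∣1+n) _ _ = a∣1+n
    from-𝟙 (no _) (no _) e = contradiction (trans (sym (suc-injective e)) (shape₀ a (a + δ))) (≢-nonZero⁻¹ a)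
      where
      shape₀ : ∀ a b → a * 0 + b * 0 ≡ 0
      shape₀ = solve-∀
    from-𝟙 (no _) (yes _) e = contradiction (+-cancelˡ-≡ a δ 0 a+δ≡a+0) (≢-nonZero⁻¹ δ)
      where
      shape₁ : ∀ a b → a * 0 + b * 1 ≡ b
      shape₁ = solve-∀
      a+δ≡a+0 : a + δ ≡ a + 0
      a+δ≡a+0 = trans (sym (shape₁ a (a + δ))) (trans (suc-injective e) (sym (+-identityʳ a)))

  a∣∧δ∤⇒g≡1+a : ∀ n → a ∣ suc n → ¬ δ ∣ suc n → g a δ n ≡ suc a
  a∣∧δ∤⇒g≡1+a n a∣1+n δ∤1+n = begin
    g a δ n
      ≡⟨ g-formula n ⟩
    1 + a * 𝟙 (a ∣? suc n) + (a + δ) * 𝟙 (δ ∣? suc n)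
      ≡⟨ cong₂ (λ u v → 1 + a * u + (a + δ) * v) (𝟙-yes _ a∣1+n) (𝟙-no _ δ∤1+n) ⟩
    1 + a * 1 + (a + δ) * 0
      ≡⟨ shape a (a + δ) ⟩
    suc a                                             ∎
    where
    open ≡-Reasoning
    shape : ∀ a b → 1 + a * 1 + b * 0 ≡ suc a
    shape = solve-∀

δ<2a⇒δ∸a<a : ∀ {a δ} .{{_ : NonZero a}} → δ < 2 * a → δ ∸ a < a
δ<2a⇒δ∸a<a {a} {δ} δ<2a = m<n+o⇒m∸n<o δ a (subst (δ <_) (cong (a +_) (+-identityʳ a)) δ<2a)

module _ (a δ : ℕ) .{{_ : NonZero a}} .{{_ : NonZero δ}} (a<δ : a < δ) (δ<2a : δ < 2 * a) where

  private
    d : ℕ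
    d = δ ∸ a

    d+a≡δ : d + a ≡ δ
    d+a≡δ = m∸n+n≡m (<⇒≤ a<δ)

    d<a : d < a
    d<a = δ<2a⇒δ∸a<a {a} {δ} δ<2a

  gap≡δ⇒ : ∀ {x A B} → x + a * A + (a + δ) * B ≡ δ → 0 < A → B ≡ 0 × x + a ≡ δ
  gap≡δ⇒ {x} {1}             {zero}  e _ = refl , trans (sym (shape x a (a + δ))) e
    where
    shape : ∀ x a b → x + a * 1 + b * 0 ≡ x + a
    shape = solve-∀
  gap≡δ⇒ {x} {suc (suc A)} {zero}  e _ = contradiction (begin-strict
    δ                                 <⟨ δ<2a ⟩
    2 * a                             ≡⟨ *-comm 2 a ⟩
    a * 2                             ≤⟨ *-monoʳ-≤ a (s≤s (s≤s z≤n)) ⟩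
    a * suc (suc A)                   ≤⟨ m≤n+m _ x ⟩
    x + a * suc (suc A)               ≤⟨ m≤m+n _ _ ⟩
    x + a * suc (suc A) + (a + δ) * 0 ≡⟨ e ⟩
    δ                                 ∎) (<-irrefl refl)
    where open ≤-Reasoning
  gap≡δ⇒ {x} {A}             {suc B} e _ = contradiction (begin-strict
    δ                             <⟨ m<n+m δ (>-nonZero⁻¹ a) ⟩
    a + δ                         ≤⟨ m≤m*n (a + δ) (suc B) ⟩
    (a + δ) * suc B               ≤⟨ m≤n+m _ _ ⟩
    x + a * A + (a + δ) * suc B   ≡⟨ e ⟩
    δ                             ∎) (<-irrefl refl)
    where open ≤-Reasoning

  w-gap≡δ⇔ : ∀ {m k} → m / a < k / a →
             (w a δ k ∸ w a δ m ≡ δ ⇔ (k ≡ m + d × k / δ ≡ m / δ))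
  w-gap≡δ⇔ {m} {k} m/a<k/a = mk⇔ to from
    where
    open ≡-Reasoning
    m≤k : m ≤ k
    m≤k = <⇒≤ (m/o<n/o⇒m<n m/a<k/a)
    A B : ℕ
    A = k / a ∸ m / a
    B = k / δ ∸ m / δ
    gap : w a δ k ∸ w a δ m ≡ (k ∸ m) + a * A + (a + δ) * B
    gap = trans (cong (_∸ w a δ m) (w-difference a δ m≤k)) (m+n∸m≡n (w a δ m) _)
    0<A : 0 < A
    0<A = m<n⇒0<n∸m m/a<k/a
    to : w a δ k ∸ w a δ m ≡ δ → k ≡ m + d × k / δ ≡ m / δ
    to e with gap≡δ⇒ (trans (sym gap) e) 0<A
    ... | B≡0 , k∸m+a≡δ = k≡m+d , ≤-antisym (m∸n≡0⇒m≤n B≡0) (/-monoˡ-≤ δ m≤k)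
      where
      k≡m+d : k ≡ m + d
      k≡m+d = begin
        k             ≡⟨ sym (m+[n∸m]≡n m≤k) ⟩
        m + (k ∸ m)   ≡⟨ cong (m +_) (sym (m+n∸n≡m (k ∸ m) a)) ⟩
        m + (k ∸ m + a ∸ a) ≡⟨ cong (λ t → m + (t ∸ a)) k∸m+a≡δ ⟩
        m + d         ∎
    from : k ≡ m + d × k / δ ≡ m / δ → w a δ k ∸ w a δ m ≡ δ
    from (refl , k/δ≡m/δ) = begin
      w a δ k ∸ w a δ m                 ≡⟨ gap ⟩
      (m + d ∸ m) + a * A + (a + δ) * B ≡⟨ cong₂ (λ u v → u + a * v + (a + δ) * B) (m+n∸m≡n m d) A≡1 ⟩
      d + a * 1 + (a + δ) * B           ≡⟨ cong (λ t → d + a * 1 + (a + δ) * t) B≡0 ⟩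
      d + a * 1 + (a + δ) * 0           ≡⟨ shape d a (a + δ) ⟩
      d + a                             ≡⟨ d+a≡δ ⟩
      δ                                 ∎
      where
      shape : ∀ d a b → d + a * 1 + b * 0 ≡ d + a
      shape = solve-∀
      A≤1 : A ≤ 1
      A≤1 = m≤n+o⇒m∸n≤o (k / a) (m / a) (subst (k / a ≤_) (trans ([m+n]/n≡1+m/n m a) (+-comm 1 (m / a)))
                                              (/-monoˡ-≤ a (+-monoʳ-≤ m (<⇒≤ d<a))))
      A≡1 : A ≡ 1
      A≡1 = ≤-antisym A≤1 0<A
      B≡0 : B ≡ 0
      B≡0 = trans (cong (_∸ m / δ) k/δ≡m/δ) (n∸n≡0 (m / δ))

  ind-sumRange-g : ∀ {m k} → m / a < k / a →
    ind (sumRange (g a δ) m k) δ ≡ 𝟙 (k ≟ m + d ×-dec k / δ ≟ m / δ)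
  ind-sumRange-g {m} {k} m/a<k/a =
    trans (cong (λ t → ind t δ) (sumRange-g a δ (<⇒≤ (m/o<n/o⇒m<n m/a<k/a))))
          (𝟙-cong (w a δ k ∸ w a δ m ≟ δ) _ (w-gap≡δ⇔ m/a<k/a))

  count-ρ≡a : ∀ i → i < d → sumFrom (λ ρ → 𝟙 (d ≤? i + ρ ×-dec i + ρ <? δ)) 1 (δ ∸ 1) ≡ a
  count-ρ≡a i i<d = begin
    sumFrom (λ ρ → 𝟙 (d ≤? i + ρ ×-dec i + ρ <? δ)) 1 (δ ∸ 1)
      ≡⟨ sumFrom-shift (λ x → 𝟙 (d ≤? x ×-dec x <? δ)) i 1 (δ ∸ 1) ⟩
    sumFrom (λ x → 𝟙 (d ≤? x ×-dec x <? δ)) (i + 1) (δ ∸ 1)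
      ≡⟨ sumFrom-𝟙-interval d δ (i + 1) (δ ∸ 1) (subst (_≤ d) (+-comm 1 i) i<d) (m∸n≤m δ a) δ≤i+1+[δ∸1] ⟩
    δ ∸ d
      ≡⟨ cong (_∸ d) (sym d+a≡δ) ⟩
    d + a ∸ d
      ≡⟨ m+n∸m≡n d a ⟩
    a ∎
    where
    open ≡-Reasoning
    δ≤i+1+[δ∸1] : δ ≤ i + 1 + (δ ∸ 1)
    δ≤i+1+[δ∸1] = subst (δ ≤_) (trans (cong (i +_) (sym (m+[n∸m]≡n (>-nonZero⁻¹ δ))))
                                      (sym (+-assoc i 1 (δ ∸ 1))))
                          (m≤n+m δ i)

  module _ (n ρ q : ℕ) (a∣1+n : a ∣ suc n) (1+n≡ρ+qδ : suc n ≡ ρ + q * δ) (ρ<δ : ρ < δ) where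

    private
      pairsFrom : ℕ → ℕ
      pairsFrom m = sumFrom (λ k → ind (sumRange (g a δ) m k) δ) (suc n) δ

      ind-across : ∀ {m k} → m < suc n → suc n ≤ k →
        ind (sumRange (g a δ) m k) δ ≡ 𝟙 (k ≟ m + d ×-dec k / δ ≟ m / δ)
      ind-across m<1+n 1+n≤k = ind-sumRange-g (m<o≤n⇒m/d<n/d a∣1+n m<1+n 1+n≤k)

    pairsFrom-far : ∀ m → m + d < suc n → pairsFrom m ≡ 0
    pairsFrom-far m m+d<1+n = sumFrom-zero (suc n) δ λ k 1+n≤k _ →
      trans (ind-across (≤-<-trans (m≤m+n m d) m+d<1+n) 1+n≤k)
            (𝟙-no _ λ (k≡m+d , _) → <⇒≱ m+d<1+n (subst (suc n ≤_) k≡m+d 1+n≤k))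

    pairsFrom-near : ∀ m → m < suc n → suc n ≤ m + d → pairsFrom m ≡ 𝟙 ((m + d) / δ ≟ m / δ)
    pairsFrom-near m m<1+n 1+n≤m+d = begin
      pairsFrom m
        ≡⟨ sumFrom-single (suc n) δ (m + d) 1+n≤m+d (+-mono-<-≤ m<1+n (m∸n≤m δ a))
             (λ k 1+n≤k _ k≢m+d → trans (ind-across m<1+n 1+n≤k) (𝟙-no _ λ (k≡m+d , _) → k≢m+d k≡m+d)) ⟩
      ind (sumRange (g a δ) m (m + d)) δ
        ≡⟨ ind-across m<1+n 1+n≤m+d ⟩
      𝟙 (m + d ≟ m + d ×-dec (m + d) / δ ≟ m / δ)
        ≡⟨ 𝟙-cong _ _ (mk⇔ proj₂ (refl ,_)) ⟩
      𝟙 ((m + d) / δ ≟ m / δ) ∎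
      where open ≡-Reasoning

    cCount≡ : cCount a δ n ≡ sumFrom (λ i → 𝟙 (d ≤? i + ρ ×-dec i + ρ <? δ)) 0 d
    cCount≡ = begin
      sumFrom pairsFrom 0 (suc n)
        ≡⟨ cong (sumFrom pairsFrom 0) (sym P+d≡1+n) ⟩
      sumFrom pairsFrom 0 (P + d)
        ≡⟨ sumFrom-++ pairsFrom 0 P d ⟩
      sumFrom pairsFrom 0 P + sumFrom pairsFrom P d
        ≡⟨ cong₂ _+_ far (cong (λ t → sumFrom pairsFrom t d) (sym (+-identityʳ P))) ⟩
      0 + sumFrom pairsFrom (P + 0) d
        ≡⟨ sym (sumFrom-shift pairsFrom P 0 d) ⟩
      0 + sumFrom (λ i → pairsFrom (P + i)) 0 d
        ≡⟨ sumFrom-cong 0 d near ⟩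
      sumFrom (λ i → 𝟙 (d ≤? i + ρ ×-dec i + ρ <? δ)) 0 d ∎
      where
      open ≡-Reasoning
      P : ℕ
      P = suc n ∸ d
      P+d≡1+n : P + d ≡ suc n
      P+d≡1+n = m∸n+n≡m (≤-trans (<⇒≤ d<a) (∣⇒≤ a∣1+n))
      far : sumFrom pairsFrom 0 P ≡ 0
      far = sumFrom-zero 0 P λ m _ m<P → pairsFrom-far m (subst (m + d <_) P+d≡1+n (+-monoˡ-< d m<P))
      near : ∀ i → 0 ≤ i → i < 0 + d → pairsFrom (P + i) ≡ 𝟙 (d ≤? i + ρ ×-dec i + ρ <? δ)
      near i _ i<d = begin
        pairsFrom (P + i)
          ≡⟨ pairsFrom-near (P + i) P+i<1+n 1+n≤P+i+d ⟩
        𝟙 ((P + i + d) / δ ≟ (P + i) / δ)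
          ≡⟨ 𝟙-cong _ _ ([m+n]/o≡m/o⇔n≤r<o {q = q} P+i+d≡i+ρ+qδ i+ρ<δ+d) ⟩
        𝟙 (d ≤? i + ρ ×-dec i + ρ <? δ) ∎
        where
        P+i+d≡1+n+i : P + i + d ≡ suc n + i
        P+i+d≡1+n+i = trans (xy∙z≈xz∙y P i d) (cong (_+ i) P+d≡1+n)
        P+i<1+n : P + i < suc n
        P+i<1+n = subst (P + i <_) P+d≡1+n (+-monoʳ-< P i<d)
        1+n≤P+i+d : suc n ≤ P + i + d
        1+n≤P+i+d = subst (suc n ≤_) (sym P+i+d≡1+n+i) (m≤m+n (suc n) i)
        P+i+d≡i+ρ+qδ : P + i + d ≡ i + ρ + q * δ
        P+i+d≡i+ρ+qδ = trans P+i+d≡1+n+i (trans (cong (_+ i) 1+n≡ρ+qδ) (shuffle ρ (q * δ) i))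
          where
          shuffle : ∀ x y z → x + y + z ≡ z + x + y
          shuffle = solve-∀
        i+ρ<δ+d : i + ρ < δ + d
        i+ρ<δ+d = subst (i + ρ <_) (+-comm d δ) (+-mono-< i<d ρ<δ)

  IsNRho⇒cCount≡ : ∀ {ρ n} → ρ < δ → IsNRho a δ ρ n →
                   cCount a δ n ≡ sumFrom (λ i → 𝟙 (d ≤? i + ρ ×-dec i + ρ <? δ)) 0 d
  IsNRho⇒cCount≡ {ρ} {n} ρ<δ (_ , g≡1+a , [1+n]%δ≡ρ%δ) =
    cCount≡ n ρ (suc n / δ) (g≡1+a⇒a∣1+n a δ n g≡1+a) 1+n≡ρ+qδ ρ<δ
    where
    1+n≡ρ+qδ : suc n ≡ ρ + suc n / δ * δ
    1+n≡ρ+qδ = trans (m≡m%n+[m/n]*n (suc n) δ)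
                     (cong (_+ suc n / δ * δ) (trans [1+n]%δ≡ρ%δ (m<n⇒m%n≡m ρ<δ)))

  sumFrom-cCount≡a*d : (nr : ℕ → ℕ) → ((ρ : ℕ) → 1 ≤ ρ → ρ < δ → IsNRho a δ ρ (nr ρ)) →
                       sumFrom (λ ρ → cCount a δ (nr ρ)) 1 (δ ∸ 1) ≡ a * d
  sumFrom-cCount≡a*d nr isNRho = begin
    sumFrom (λ ρ → cCount a δ (nr ρ)) 1 (δ ∸ 1)         ≡⟨ sumFrom-cong 1 (δ ∸ 1) cCount-nr ⟩
    sumFrom (λ ρ → sumFrom (χ ρ) 0 d) 1 (δ ∸ 1)         ≡⟨ sumFrom-comm χ 1 (δ ∸ 1) 0 d ⟩
    sumFrom (λ i → sumFrom (λ ρ → χ ρ i) 1 (δ ∸ 1)) 0 d ≡⟨ sumFrom-cong 0 d (λ i _ i<d → count-ρ≡a i i<d) ⟩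
    sumFrom (λ _ → a) 0 d                               ≡⟨ sumFrom-const a 0 d ⟩
    d * a                                               ≡⟨ *-comm d a ⟩
    a * d                                               ∎
    where
    open ≡-Reasoning
    χ : ℕ → ℕ → ℕ
    χ ρ i = 𝟙 (d ≤? i + ρ ×-dec i + ρ <? δ)
    cCount-nr : ∀ ρ → 1 ≤ ρ → ρ < 1 + (δ ∸ 1) → cCount a δ (nr ρ) ≡ sumFrom (χ ρ) 0 d
    cCount-nr ρ 1≤ρ ρ<1+[δ∸1] = IsNRho⇒cCount≡ ρ<δ (isNRho ρ 1≤ρ ρ<δ)
      where
      ρ<δ : ρ < δ
      ρ<δ = subst (ρ <_) (m+[n∸m]≡n (>-nonZero⁻¹ δ)) ρ<1+[δ∸1]

module _ (a δ : ℕ) .{{_ : NonZero a}} .{{_ : NonZero δ}} {ρ : ℕ} (ρ%δ≢0 : ρ % δ ≢ 0) where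

  IsNRho⇒[1+n]/a<δ : ∀ {n} → IsNRho a δ ρ n → suc n / a < δ
  IsNRho⇒[1+n]/a<δ {n} (n<aδ , g≡1+a , [1+n]%δ≡ρ%δ) = ≤∧≢⇒< j≤δ j≢δ
    where
    open ≡-Reasoning
    j : ℕ
    j = suc n / a
    ja≡1+n : j * a ≡ suc n
    ja≡1+n = m/n*n≡m (g≡1+a⇒a∣1+n a δ n g≡1+a)
    j≤δ : j ≤ δ
    j≤δ = *-cancelʳ-≤ j δ a (subst₂ _≤_ (sym ja≡1+n) (*-comm a δ) n<aδ)
    j≢δ : j ≢ δ
    j≢δ j≡δ = ρ%δ≢0 (begin
      ρ % δ       ≡⟨ [1+n]%δ≡ρ%δ ⟨
      suc n % δ   ≡⟨ %-congˡ (trans (sym ja≡1+n) (trans (cong (_* a) j≡δ) (*-comm δ a))) ⟩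
      (a * δ) % δ ≡⟨ m*n%n≡0 a δ ⟩
      0           ∎)

  IsNRho-unique : Coprime a δ → ∀ {n₁ n₂} → IsNRho a δ ρ n₁ → IsNRho a δ ρ n₂ → n₁ ≡ n₂
  IsNRho-unique coprime {n₁} {n₂} H₁@(_ , g₁ , r₁) H₂@(_ , g₂ , r₂) = suc-injective (begin
    suc n₁           ≡⟨ m/n*n≡m a∣1+n₁ ⟨
    suc n₁ / a * a   ≡⟨ cong (_* a) j₁≡j₂ ⟩
    suc n₂ / a * a   ≡⟨ m/n*n≡m a∣1+n₂ ⟩
    suc n₂           ∎)
    where
    open ≡-Reasoning
    a∣1+n₁ : a ∣ suc n₁
    a∣1+n₁ = g≡1+a⇒a∣1+n a δ n₁ g₁
    a∣1+n₂ : a ∣ suc n₂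
    a∣1+n₂ = g≡1+a⇒a∣1+n a δ n₂ g₂
    j₁≡j₂ : suc n₁ / a ≡ suc n₂ / a
    j₁≡j₂ = begin
      suc n₁ / a       ≡⟨ m<n⇒m%n≡m (IsNRho⇒[1+n]/a<δ H₁) ⟨
      suc n₁ / a % δ   ≡⟨ *-cancelʳ-% coprime (begin
        (suc n₁ / a * a) % δ ≡⟨ %-congˡ (m/n*n≡m a∣1+n₁) ⟩
        suc n₁ % δ           ≡⟨ trans r₁ (sym r₂) ⟩
        suc n₂ % δ           ≡⟨ %-congˡ (m/n*n≡m a∣1+n₂) ⟨
        (suc n₂ / a * a) % δ ∎) ⟩
      suc n₂ / a % δ   ≡⟨ m<n⇒m%n≡m (IsNRho⇒[1+n]/a<δ H₂) ⟩
      suc n₂ / a       ∎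

  solution⇒IsNRho : ∀ j → j < δ → (j * a) % δ ≡ ρ % δ → ∃[ n ] IsNRho a δ ρ n
  solution⇒IsNRho zero        _   0≡ρ%δ    = contradiction (trans (sym 0≡ρ%δ) (m*n%n≡0 0 δ)) ρ%δ≢0
  solution⇒IsNRho j@(suc _) j<δ ja%δ≡ρ%δ =
    n , n<aδ , a∣∧δ∤⇒g≡1+a a δ n (divides j 1+n≡ja) δ∤1+n , trans (%-congˡ 1+n≡ja) ja%δ≡ρ%δ
    where
    n : ℕ
    n = pred (j * a)
    1+n≡ja : suc n ≡ j * a
    1+n≡ja = suc-pred (j * a) {{m*n≢0 j a}}
    n<aδ : n < a * δ
    n<aδ = <-trans (subst (n <_) 1+n≡ja (n<1+n n)) (subst (j * a <_) (*-comm δ a) (*-monoˡ-< a j<δ))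
    δ∤1+n : ¬ δ ∣ suc n
    δ∤1+n δ∣1+n = ρ%δ≢0 (trans (sym (trans (%-congˡ 1+n≡ja) ja%δ≡ρ%δ)) (n∣m⇒m%n≡0 (suc n) δ δ∣1+n))

  IsNRho-exists : Coprime a δ → ∃[ n ] IsNRho a δ ρ n
  IsNRho-exists coprime = let j , j<δ , ja%δ≡ρ%δ = *-surjectiveʳ-% coprime ρ in solution⇒IsNRho j j<δ ja%δ≡ρ%δ

lemma4p5 : (a δ : ℕ) .{{_ : NonZero a}} .{{_ : NonZero δ}} →
    a < δ → δ < 2 * a → gcd a δ ≡ 1 →
    ((ρ : ℕ) → 1 ≤ ρ → ρ < δ →
      ∃[ n ] (IsNRho a δ ρ n × ((n' : ℕ) → IsNRho a δ ρ n' → n' ≡ n)))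
    × ((nr : ℕ → ℕ) → ((ρ : ℕ) → 1 ≤ ρ → ρ < δ → IsNRho a δ ρ (nr ρ)) →
      (sumFrom (λ ρ → cCount a δ (nr ρ)) 1 (δ ∸ 1)
         ≡ sumFrom (λ k → 2 * k) 1 (δ ∸ a) + (a ∸ (δ ∸ a) ∸ 1) * (δ ∸ a))
      × (sumFrom (λ k → 2 * k) 1 (δ ∸ a) + (a ∸ (δ ∸ a) ∸ 1) * (δ ∸ a) ≡ a * (δ ∸ a)))
lemma4p5 a δ a<δ δ<2a gcd≡1 =
  nρ , λ nr isNRho → trans (sumFrom-cCount≡a*d a δ a<δ δ<2a nr isNRho) (sym closed) , closed
  where
  coprime : Coprime a δ
  coprime = gcd≡1⇒coprime gcd≡1
  ρ%δ≢0 : ∀ {ρ} → 1 ≤ ρ → ρ < δ → ρ % δ ≢ 0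
  ρ%δ≢0 1≤ρ ρ<δ ρ%δ≡0 = <⇒≢ 1≤ρ (sym (trans (sym (m<n⇒m%n≡m ρ<δ)) ρ%δ≡0))
  nρ : (ρ : ℕ) → 1 ≤ ρ → ρ < δ → ∃[ n ] (IsNRho a δ ρ n × ((n' : ℕ) → IsNRho a δ ρ n' → n' ≡ n))
  nρ ρ 1≤ρ ρ<δ = let n , H = IsNRho-exists a δ (ρ%δ≢0 1≤ρ ρ<δ) coprime in
                 n , H , λ n' H' → IsNRho-unique a δ (ρ%δ≢0 1≤ρ ρ<δ) coprime H' H
  closed : sumFrom (λ k → 2 * k) 1 (δ ∸ a) + (a ∸ (δ ∸ a) ∸ 1) * (δ ∸ a) ≡ a * (δ ∸ a)
  closed = sumFrom-2k+[a∸d∸1]*d (δ<2a⇒δ∸a<a {a} {δ} δ<2a)
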